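{- Let $n,m\geq 0$ be integers and let $P(n,m)=\Delta_{n-1}*\square*\cdots*\square$ ($m$ copies of $\square$). Then \[ k(P(n,m)) = \begin{cases} \lfloor (4m+n)/3\rfloor, & n\leq 2m-1,\\ \lfloor (2m+n)/2\rfloor, & n\geq 2m-1.\end{cases}\] Equivalently, writing $d=\dim P(n,m)=n-1+3m$ and $\gamma=m$ (so that $P(n,m)$ has $d+\gamma+1=4m+n$ vertices), \[ k(P(n,m)) = \begin{cases} \lfloor (d+\gamma+1)/3\rfloor, & d\leq 5\gamma-2,\\ \lfloor (d-\gamma+1)/2\rfloor, & d\geq 5\gamma-2.\end{cases}\]
   Context: Polytopes are considered up to combinatorial equivalence. $\Delta_j$ denotes the $j$-dimensional simplex ($\Delta_{ -1}$ is the empty polytope, which acts as identity for the join), and $\square$ denotes a quadrilateral (2-dimensional). $P*Q$ denotes the join of polytopes $P$ and $Q$ (convex hull of copies of $P$ and $Q$ lying in skew affine subspaces; $\dim(P*Q)=\dim P+\dim Q+1$, and its faces are the joins of faces of $P$ and $Q$). A graph $G=(V,E)$ is $k$-linked if $|V|\geq 2k$ and for every choice of $2k$ distinct vertices $s_1,\dots,s_k,t_1,\dots,t_k$ there exist $k$ pairwise vertex-disjoint paths $L_1,\dots,L_k$ with $L_i$ joining $s_i$ and $t_i$; a polytope is $k$-linked if its graph (vertices and edges) is, and $k(P)=\max\{k : P \text{ is } k\text{ -linked}\}$. -}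

module Defs where

open import Data.Nat using (ℕ; zero; suc; _+_; _*_; _≤_; _%_)
open import Data.Fin using (Fin; toℕ; splitAt)
open import Data.Sum using (_⊎_; inj₁; inj₂)
open import Data.Product using (Σ; _×_; _,_)
open import Data.Unit using (⊤)
open import Data.Empty using (⊥)
open import Data.List using (List; []; _∷_)
open import Data.List.Membership.Propositional using (_∈_)
open import Data.List.Relation.Unary.Unique.Propositional using (Unique)
open import Relation.Binary.PropositionalEquality using (_≡_; _≢_)

record Graph : Set₁ where
  field
    size : ℕ
    Adj  : Fin size → Fin size → Set
open Graph public

-- Graph of the join P * Q of polytopes: disjoint union of the graphs of P and Q,
-- plus every edge between a vertex of P and a vertex of Q
-- (the faces of P*Q are the joins of faces of P and Q).
joinG : Graph → Graph → Graph
joinG G H = record { size = size G + size H ; Adj = adj }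
  where
  adj : Fin (size G + size H) → Fin (size G + size H) → Set
  adj x y with splitAt (size G) x | splitAt (size G) y
  ... | inj₁ a | inj₁ b = Adj G a b
  ... | inj₂ a | inj₂ b = Adj H a b
  ... | inj₁ _ | inj₂ _ = ⊤
  ... | inj₂ _ | inj₁ _ = ⊤

-- Graph of the simplex Δ_{n-1}: the complete graph on n vertices.
simplexG : ℕ → Graph
simplexG n = record { size = n ; Adj = λ x y → x ≢ y }

squareG : Graph
squareG = record { size = 4 ; Adj = λ i j → (toℕ j ≡ (toℕ i + 1) % 4) ⊎ (toℕ i ≡ (toℕ j + 1) % 4) }

PG : ℕ → ℕ → Graph
PG n zero    = simplexG n
PG n (suc m) = joinG (PG n m) squareG

data Walk (G : Graph) : Fin (size G) → Fin (size G) → List (Fin (size G)) → Set where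
  here : ∀ v → Walk G v v (v ∷ [])
  step : ∀ {u v w vs} → Adj G u v → Walk G v w vs → Walk G u w (u ∷ vs)

IsPath : (G : Graph) → Fin (size G) → Fin (size G) → List (Fin (size G)) → Set
IsPath G s t vs = Walk G s t vs × Unique vs

Linked : Graph → ℕ → Set
Linked G k =
  (2 * k ≤ size G) ×
  ((s t : Fin k → Fin (size G)) →
    (∀ i j → s i ≡ s j → i ≡ j) →
    (∀ i j → t i ≡ t j → i ≡ j) →
    (∀ i j → s i ≢ t j) →
    Σ (Fin k → List (Fin (size G))) λ L →
      (∀ i → IsPath G (s i) (t i) (L i)) ×
      (∀ i j → i ≢ j → ∀ x → x ∈ L i → x ∈ L j → ⊥))

LinkNumber : Graph → ℕ → Set
LinkNumber G k = Linked G k × (∀ k' → Linked G k' → k' ≤ k)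

-- Apart from the diagonals of its m quadrilaterals, which form a matching, the graph of
-- P(n, m) is complete.  Upper bound: place min(k, 2m) terminal pairs on diagonals; each
-- of their paths needs an interior vertex, and these are distinct from one another and
-- from the 2k terminals, so k-linkedness forces 2k + min(k, 2m) ≤ n + 4m.  Lower bound:
-- as non-edges form a matching, a non-adjacent terminal pair is joined through any other
-- vertex, so it suffices to give each non-adjacent pair its own vertex off the terminals.
-- There are at most k such pairs, and at most 2m (they are disjoint diagonals), which
-- settles k = ⌊(4m+n)/3⌋ and k = ⌊(2m+n)/2⌋ respectively.

module Submission where

open import Defs
open import Data.Nat using (ℕ; zero; suc; _+_; _*_; _≤_; _<_; _∸_; _⊓_; _/_; NonZero; z≤n; s≤s)
open import Data.Nat.Properties hiding (_≟_)
open import Data.Nat.DivMod using (m/n*n≤m; m*n/n≡m; /-monoˡ-≤)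
open import Data.Nat.Tactic.RingSolver using (solve-∀)
open import Data.Fin using (Fin; zero; suc; _↑ˡ_; _↑ʳ_; splitAt; join; inject≤)
open import Data.Fin.Patterns using (0F; 1F; 2F; 3F)
open import Data.Fin.Properties
  using (_≟_; splitAt-↑ˡ; splitAt-↑ʳ; join-splitAt; ↑ˡ-injective; ↑ʳ-injective; inject≤-injective;
         injective⇒≤; all?; any?; ¬∀⟶∃¬)
open import Data.Vec.Functional using (_++_)
import Data.Vec.Functional as Vector
open import Data.Vec.Functional.Properties using (lookup-++ˡ; lookup-++ʳ)
open import Data.Product using (Σ; ∃; _×_; _,_; proj₁; proj₂)
import Data.Product as Product
open import Data.Sum using (_⊎_; inj₁; inj₂; [_,_]′)
import Data.Sum as Sum
open import Data.Sum.Properties using ([,]-∘)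
open import Data.Empty using (⊥; ⊥-elim)
open import Data.Unit using (⊤; tt)
open import Data.List using (List; []; _∷_)
open import Data.List.Membership.Propositional using (_∈_)
open import Data.List.Relation.Unary.Any using (here; there)
import Data.List.Relation.Unary.All as All
open import Data.List.Relation.Unary.All using (All; []; _∷_)
open import Data.List.Relation.Unary.AllPairs using ([]; _∷_)
open import Function using (_∘_; id)
open import Function.Definitions using (Injective)
open import Relation.Nullary using (¬_; yes; no; contradiction)
open import Relation.Nullary.Decidable
  using (from-yes; decidable-stable; ¬?; _⊎-dec_; _×-dec_; _→-dec_; map′)
open import Relation.Binary.Definitions using (Decidable)
open import Relation.Binary.PropositionalEquality

-- Injections between finite sets

splitAt-injective : ∀ m {n} → Injective _≡_ _≡_ (splitAt m {n})
splitAt-injective m {n} {i} {j} eq = begin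
  i                      ≡⟨ join-splitAt m n i ⟨
  join m n (splitAt m i) ≡⟨ cong (join m n) eq ⟩
  join m n (splitAt m j) ≡⟨ join-splitAt m n j ⟩
  j                      ∎
  where open ≡-Reasoning

↑ˡ≢↑ʳ : ∀ {m n} (i : Fin m) (j : Fin n) → i ↑ˡ n ≢ m ↑ʳ j
↑ˡ≢↑ʳ {m} {n} i j eq
  with trans (sym (splitAt-↑ˡ m i n)) (trans (cong (splitAt m) eq) (splitAt-↑ʳ m n j))
... | ()

[,]-injective : ∀ {A B C : Set} {f : A → C} {g : B → C} →
  Injective _≡_ _≡_ f → Injective _≡_ _≡_ g → (∀ a b → f a ≢ g b) → Injective _≡_ _≡_ [ f , g ]′
[,]-injective f-inj g-inj f≢g {inj₁ a} {inj₁ a′} eq = cong inj₁ (f-inj eq)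
[,]-injective f-inj g-inj f≢g {inj₁ a} {inj₂ b}  eq = ⊥-elim (f≢g a b eq)
[,]-injective f-inj g-inj f≢g {inj₂ b} {inj₁ a}  eq = ⊥-elim (f≢g a b (sym eq))
[,]-injective f-inj g-inj f≢g {inj₂ b} {inj₂ b′} eq = cong inj₂ (g-inj eq)

module _ {A : Set} where

  ++-injective : ∀ {m n} {f : Fin m → A} {g : Fin n → A} →
    Injective _≡_ _≡_ f → Injective _≡_ _≡_ g → (∀ i j → f i ≢ g j) → Injective _≡_ _≡_ (f ++ g)
  ++-injective {m} f-inj g-inj f≢g eq = splitAt-injective m ([,]-injective f-inj g-inj f≢g eq)

  ++-avoids : ∀ {m n} {f : Fin m → A} {g : Fin n → A} {x} →
    (∀ i → f i ≢ x) → (∀ i → g i ≢ x) → ∀ i → (f ++ g) i ≢ x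
  ++-avoids {m} f≢x g≢x i with splitAt m i
  ... | inj₁ a = f≢x a
  ... | inj₂ b = g≢x b

  ++-apart : ∀ {m n} {f f′ : Fin m → A} {g g′ : Fin n → A} →
    (∀ i j → f i ≢ f′ j) → (∀ i j → f i ≢ g′ j) → (∀ i j → g i ≢ f′ j) → (∀ i j → g i ≢ g′ j) →
    ∀ i j → (f ++ g) i ≢ (f′ ++ g′) j
  ++-apart {m} ff fg gf gg i j with splitAt m i | splitAt m j
  ... | inj₁ a | inj₁ b = ff a b
  ... | inj₁ a | inj₂ b = fg a b
  ... | inj₂ a | inj₁ b = gf a b
  ... | inj₂ a | inj₂ b = gg a b

  ∷-injective : ∀ {n} {x : A} {f : Fin n → A} → (∀ i → f i ≢ x) → Injective _≡_ _≡_ f →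
    Injective _≡_ _≡_ (x Vector.∷ f)
  ∷-injective x∉f f-inj {zero}  {zero}  _  = refl
  ∷-injective x∉f f-inj {zero}  {suc j} eq = ⊥-elim (x∉f j (sym eq))
  ∷-injective x∉f f-inj {suc i} {zero}  eq = ⊥-elim (x∉f i eq)
  ∷-injective x∉f f-inj {suc i} {suc j} eq = cong suc (f-inj eq)

-- Otherwise every point has a preimage, and choosing preimages injects Fin n into Fin a.
outside-image : ∀ {a n} (g : Fin a → Fin n) → a < n → ∃ λ y → ∀ i → g i ≢ y
outside-image {a} g a<n with any? (λ y → all? λ i → ¬? (g i ≟ y))
... | yes missed = missed
... | no ¬missed = contradiction (injective⇒≤ preimage-injective) (<⇒≱ a<n)
  where
  preimage : ∀ y → ∃ λ i → g i ≡ y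
  preimage y = Product.map₂ (λ {i} → decidable-stable (g i ≟ y))
                 (¬∀⟶∃¬ a _ (λ i → ¬? (g i ≟ y)) (λ avoids → ¬missed (y , avoids)))

  preimage-injective : Injective _≡_ _≡_ (proj₁ ∘ preimage)
  preimage-injective {y} {y′} eq =
    trans (sym (proj₂ (preimage y))) (trans (cong g eq) (proj₂ (preimage y′)))

injection-extension : ∀ {a n} b (g : Fin a → Fin n) → Injective _≡_ _≡_ g → a + b ≤ n →
  Σ (Fin b → Fin n) λ h → Injective _≡_ _≡_ h × (∀ i j → h i ≢ g j)
injection-extension zero g g-inj _ = (λ ()) , (λ { {()} }) , (λ ())
injection-extension {a} {n} (suc b) g g-inj a+b≤n
  with outside-image g (<-≤-trans (m<m+n a (s≤s z≤n)) a+b≤n)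
... | y , y∉g
  with injection-extension b (y Vector.∷ g) (∷-injective y∉g g-inj) (subst (_≤ n) (+-suc a b) a+b≤n)
... | h , h-inj , h∉y∷g = y Vector.∷ h , ∷-injective (λ i → h∉y∷g i zero) h-inj , apart
  where
  apart : ∀ i j → (y Vector.∷ h) i ≢ g j
  apart zero    j = y∉g j ∘ sym
  apart (suc i) j = h∉y∷g i (suc j)

-- Terminal sets

record Terminals (n k : ℕ) : Set where
  field
    source target    : Fin k → Fin n
    source-injective : Injective _≡_ _≡_ source
    target-injective : Injective _≡_ _≡_ target
    source≢target    : ∀ i j → source i ≢ target j

  endpoints : Fin (k + k) → Fin n
  endpoints = source ++ target

  endpoints-injective : Injective _≡_ _≡_ endpoints
  endpoints-injective = ++-injective source-injective target-injective source≢target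

  endpoints-source : ∀ i → endpoints (i ↑ˡ k) ≡ source i
  endpoints-source = lookup-++ˡ source target

  endpoints-target : ∀ i → endpoints (k ↑ʳ i) ≡ target i
  endpoints-target = lookup-++ʳ source target

open Terminals

terminalsFromInjection : ∀ {n k} (e : Fin (k + k) → Fin n) → Injective _≡_ _≡_ e → Terminals n k
terminalsFromInjection {k = k} e e-inj = record
  { source           = e ∘ (_↑ˡ k)
  ; target           = e ∘ (k ↑ʳ_)
  ; source-injective = λ eq → ↑ˡ-injective k _ _ (e-inj eq)
  ; target-injective = λ eq → ↑ʳ-injective k _ _ (e-inj eq)
  ; source≢target    = λ i j eq → ↑ˡ≢↑ʳ i j (e-inj eq)
  }

endpoints-fromInjection : ∀ {n k} (e : Fin (k + k) → Fin n) (e-inj : Injective _≡_ _≡_ e) j →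
  endpoints (terminalsFromInjection {k = k} e e-inj) j ≡ e j
endpoints-fromInjection {k = k} e _ j =
  trans (sym ([,]-∘ e {_↑ˡ k} {k ↑ʳ_} (splitAt k j))) (cong e (join-splitAt k k j))

mapTerminals : ∀ {n n′ k} (f : Fin n → Fin n′) → Injective _≡_ _≡_ f → Terminals n k → Terminals n′ k
mapTerminals f f-inj T = record
  { source           = f ∘ source T
  ; target           = f ∘ target T
  ; source-injective = source-injective T ∘ f-inj
  ; target-injective = target-injective T ∘ f-inj
  ; source≢target    = λ i j → source≢target T i j ∘ f-inj
  }

endpoints-map : ∀ {n n′ k} (f : Fin n → Fin n′) (f-inj : Injective _≡_ _≡_ f) (T : Terminals n k) j →
  endpoints (mapTerminals f f-inj T) j ≡ f (endpoints T j)
endpoints-map {k = k} f _ T j = sym ([,]-∘ f {source T} {target T} (splitAt k j))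

reindexTerminals : ∀ {n k b} (ρ : Fin b → Fin k) → Injective _≡_ _≡_ ρ → Terminals n k → Terminals n b
reindexTerminals ρ ρ-inj T = record
  { source           = source T ∘ ρ
  ; target           = target T ∘ ρ
  ; source-injective = ρ-inj ∘ source-injective T
  ; target-injective = ρ-inj ∘ target-injective T
  ; source≢target    = λ i j → source≢target T (ρ i) (ρ j)
  }

Apart : ∀ {n k l} → Terminals n k → Terminals n l → Set
Apart T U = ∀ i j → endpoints T i ≢ endpoints U j

appendTerminals : ∀ {n k l} (T : Terminals n k) (U : Terminals n l) → Apart T U → Terminals n (k + l)
appendTerminals {k = k} {l} T U apart = record
  { source           = source T ++ source U
  ; target           = target T ++ target U
  ; source-injective = ++-injective (source-injective T) (source-injective U)
                         λ i j → apart-at (i ↑ˡ k) (j ↑ˡ l) (endpoints-source T i) (endpoints-source U j)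
  ; target-injective = ++-injective (target-injective T) (target-injective U)
                         λ i j → apart-at (k ↑ʳ i) (l ↑ʳ j) (endpoints-target T i) (endpoints-target U j)
  ; source≢target    = ++-apart (source≢target T)
                         (λ i j → apart-at (i ↑ˡ k) (l ↑ʳ j) (endpoints-source T i) (endpoints-target U j))
                         (λ i j → apart-at (k ↑ʳ j) (i ↑ˡ l) (endpoints-target T j) (endpoints-source U i) ∘ sym)
                         (source≢target U)
  }
  where
  apart-at : ∀ i j {x y} → endpoints T i ≡ x → endpoints U j ≡ y → x ≢ y
  apart-at i j refl refl = apart i j

freshTerminals : ∀ {n k} r (T : Terminals n k) → k + k + (r + r) ≤ n → Σ (Terminals n r) (Apart T)
freshTerminals r T fits with injection-extension (r + r) (endpoints T) (endpoints-injective T) fits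
... | h , h-inj , h∉T = terminalsFromInjection h h-inj
                      , λ i j eq → h∉T j i (trans (sym (endpoints-fromInjection {k = r} h h-inj j)) (sym eq))

-- Linkages in graphs whose non-edges form a matching

Linkage : (G : Graph) {k : ℕ} → Terminals (size G) k → Set
Linkage G {k} T = Σ (Fin k → List (Fin (size G))) λ L →
  (∀ i → IsPath G (source T i) (target T i) (L i)) ×
  (∀ i j → i ≢ j → ∀ x → x ∈ L i → x ∈ L j → ⊥)

linked⇒linkage : ∀ {G k} → Linked G k → (T : Terminals (size G) k) → Linkage G T
linked⇒linkage (_ , link) T =
  link (source T) (target T) (λ _ _ → source-injective T) (λ _ _ → target-injective T) (source≢target T)

linkage⇒linked : ∀ {G k} → 2 * k ≤ size G → (∀ T → Linkage G T) → Linked G k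
linkage⇒linked fits link = fits , λ s t s-inj t-inj s≢t → link record
  { source = s ; target = t
  ; source-injective = s-inj _ _ ; target-injective = t-inj _ _ ; source≢target = s≢t }

start∈walk : ∀ {G s t vs} → Walk G s t vs → s ∈ vs
start∈walk (here _)   = here refl
start∈walk (step _ _) = here refl

end∈walk : ∀ {G s t vs} → Walk G s t vs → t ∈ vs
end∈walk (here _)      = here refl
end∈walk (step _ walk) = there (end∈walk walk)

path-interior : ∀ {G s t vs} → IsPath G s t vs → ¬ Adj G s t → s ≢ t → ∃ λ v → v ∈ vs × v ≢ s × v ≢ t
path-interior (here _ , _) _ s≢t = ⊥-elim (s≢t refl)
path-interior {t = t} (step {v = v} s~v walk , s∉vs ∷ _) s≁t _ with v ≟ t
... | yes refl = ⊥-elim (s≁t s~v)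
... | no v≢t   = v , there (start∈walk walk) , (λ v≡s → All.lookup s∉vs (start∈walk walk) (sym v≡s)) , v≢t

-- The non-edges of such a graph form a matching.
CoMatching : Graph → Set
CoMatching G = ∀ {x y z} → x ≢ y → ¬ Adj G x y → z ≢ x → z ≢ y → Adj G x z × Adj G z y

record NonEdgeFamily (G : Graph) (c : ℕ) : Set where
  field
    terminals   : Terminals (size G) c
    nonadjacent : ∀ i → ¬ Adj G (source terminals i) (target terminals i)

open NonEdgeFamily

restrictFamily : ∀ {G c b} → NonEdgeFamily G c → b ≤ c → NonEdgeFamily G b
restrictFamily F b≤c = record
  { terminals   = reindexTerminals (λ i → inject≤ i b≤c) (inject≤-injective b≤c b≤c _ _) (terminals F)
  ; nonadjacent = λ i → nonadjacent F (inject≤ i b≤c)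
  }

record NonEdgeLabelling (G : Graph) (c : ℕ) : Set where
  field
    label           : ∀ {x y} → x ≢ y → ¬ Adj G x y → Fin c
    label-injective : ∀ {x y x′ y′} (p : x ≢ y) (q : ¬ Adj G x y) (p′ : x′ ≢ y′) (q′ : ¬ Adj G x′ y′) →
                      label p q ≡ label p′ q′ → x ≡ x′ ⊎ x ≡ y′

record PairLabelling (G : Graph) {k : ℕ} (T : Terminals (size G) k) (c : ℕ) : Set where
  field
    label           : ∀ i → ¬ Adj G (source T i) (target T i) → Fin c
    label-injective : ∀ {i j} p q → label i p ≡ label j q → i ≡ j

indexLabelling : ∀ {G k} (T : Terminals (size G) k) → PairLabelling G T k
indexLabelling T = record { label = λ i _ → i ; label-injective = λ _ _ eq → eq }

nonEdgeLabelling⇒pairLabelling : ∀ {G c k} → NonEdgeLabelling G c → (T : Terminals (size G) k) →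
  PairLabelling G T c
nonEdgeLabelling⇒pairLabelling Λ T = record
  { label           = λ i → label (source≢target T i i)
  ; label-injective = λ p q eq → [ source-injective T , (λ s≡t → ⊥-elim (source≢target T _ _ s≡t)) ]′
                                   (label-injective _ p _ q eq)
  }
  where open NonEdgeLabelling Λ

module _ {G : Graph} {k b : ℕ} (T : Terminals (size G) k) (e : Fin b → Fin k) (e-inj : Injective _≡_ _≡_ e)
         (nonadjacent : ∀ i → ¬ Adj G (source T (e i)) (target T (e i))) (linkage : Linkage G T) where

  private
    L : Fin k → List (Fin (size G))
    L = proj₁ linkage

    paths : ∀ i → IsPath G (source T i) (target T i) (L i)
    paths = proj₁ (proj₂ linkage)

    sharedVertex⇒samePath : ∀ {p q x} → x ∈ L p → x ∈ L q → p ≡ q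
    sharedVertex⇒samePath {p} {q} x∈p x∈q with p ≟ q
    ... | yes p≡q = p≡q
    ... | no p≢q  = ⊥-elim (proj₂ (proj₂ linkage) p q p≢q _ x∈p x∈q)

    interior : ∀ i → ∃ λ v → v ∈ L (e i) × v ≢ source T (e i) × v ≢ target T (e i)
    interior i = path-interior (paths (e i)) (nonadjacent i) (source≢target T (e i) (e i))

    interior∈ : ∀ i → proj₁ (interior i) ∈ L (e i)
    interior∈ i = proj₁ (proj₂ (interior i))

    interior-injective : Injective _≡_ _≡_ (proj₁ ∘ interior)
    interior-injective {i} {j} eq =
      e-inj (sharedVertex⇒samePath (interior∈ i) (subst (_∈ L (e j)) (sym eq) (interior∈ j)))

    source≢interior : ∀ i p → source T p ≢ proj₁ (interior i)
    source≢interior i p eq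
      with sharedVertex⇒samePath (start∈walk (proj₁ (paths p))) (subst (_∈ L (e i)) (sym eq) (interior∈ i))
    ... | refl = proj₁ (proj₂ (proj₂ (interior i))) (sym eq)

    target≢interior : ∀ i p → target T p ≢ proj₁ (interior i)
    target≢interior i p eq
      with sharedVertex⇒samePath (end∈walk (proj₁ (paths p))) (subst (_∈ L (e i)) (sym eq) (interior∈ i))
    ... | refl = proj₂ (proj₂ (proj₂ (interior i))) (sym eq)

  linkage⇒k+k+b≤size : k + k + b ≤ size G
  linkage⇒k+k+b≤size = injective⇒≤ (++-injective (endpoints-injective T) interior-injective
                                 λ j i → ++-avoids (source≢interior i) (target≢interior i) j)

linked⇒k+k+b≤size : ∀ {G k b} → Linked G k → NonEdgeFamily G b → b ≤ k → k + k + b ≤ size G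
linked⇒k+k+b≤size {G} {k} {b} linked F b≤k =
  subst (λ k → k + k + b ≤ size G) b+r≡k
    (linkage⇒k+k+b≤size T (_↑ˡ r) (↑ˡ-injective r _ _) nonadjacent′ (linked⇒linkage linked′ T))
  where
  r : ℕ
  r = k ∸ b

  b+r≡k : b + r ≡ k
  b+r≡k = m+[n∸m]≡n b≤k

  linked′ : Linked G (b + r)
  linked′ = subst (Linked G) (sym b+r≡k) linked

  double-+ : ∀ b r → 2 * (b + r) ≡ b + b + (r + r)
  double-+ = solve-∀

  fresh : Σ (Terminals (size G) r) (Apart (terminals F))
  fresh = freshTerminals r (terminals F) (subst (_≤ size G) (double-+ b r) (proj₁ linked′))

  T : Terminals (size G) (b + r)
  T = appendTerminals (terminals F) (proj₁ fresh) (proj₂ fresh)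

  nonadjacent′ : ∀ i → ¬ Adj G (source T (i ↑ˡ r)) (target T (i ↑ˡ r))
  nonadjacent′ i = subst₂ (λ x y → ¬ Adj G x y)
                     (sym (lookup-++ˡ _ _ i)) (sym (lookup-++ˡ _ _ i)) (nonadjacent F i)

module _ {G : Graph} {k c : ℕ} (coMatching : CoMatching G) (adj? : Decidable (Adj G))
         (T : Terminals (size G) k) (Λ : PairLabelling G T c) (fits : k + k + c ≤ size G) where

  open PairLabelling Λ

  private
    relays : Σ (Fin c → Fin (size G)) λ h → Injective _≡_ _≡_ h × (∀ l j → h l ≢ endpoints T j)
    relays = injection-extension c (endpoints T) (endpoints-injective T) fits

    relay : ∀ i → ¬ Adj G (source T i) (target T i) → Fin (size G)
    relay i p = proj₁ relays (label i p)

    relay≢source : ∀ i p j → relay i p ≢ source T j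
    relay≢source i p j eq = proj₂ (proj₂ relays) (label i p) (j ↑ˡ k) (trans eq (sym (endpoints-source T j)))

    relay≢target : ∀ i p j → relay i p ≢ target T j
    relay≢target i p j eq = proj₂ (proj₂ relays) (label i p) (k ↑ʳ j) (trans eq (sym (endpoints-target T j)))

    data OnRoute (i : Fin k) (x : Fin (size G)) : Set where
      at-source : x ≡ source T i → OnRoute i x
      at-target : x ≡ target T i → OnRoute i x
      at-relay  : ∀ p → x ≡ relay i p → OnRoute i x

    onRoute-unique : ∀ {i j x} → OnRoute i x → OnRoute j x → i ≡ j
    onRoute-unique (at-source refl)  (at-source e)  = source-injective T e
    onRoute-unique (at-source refl)  (at-target e)  = ⊥-elim (source≢target T _ _ e)
    onRoute-unique (at-source refl)  (at-relay q e) = ⊥-elim (relay≢source _ q _ (sym e))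
    onRoute-unique (at-target refl)  (at-source e)  = ⊥-elim (source≢target T _ _ (sym e))
    onRoute-unique (at-target refl)  (at-target e)  = target-injective T e
    onRoute-unique (at-target refl)  (at-relay q e) = ⊥-elim (relay≢target _ q _ (sym e))
    onRoute-unique (at-relay p refl) (at-source e)  = ⊥-elim (relay≢source _ p _ e)
    onRoute-unique (at-relay p refl) (at-target e)  = ⊥-elim (relay≢target _ p _ e)
    onRoute-unique (at-relay p refl) (at-relay q e) = label-injective p q (proj₁ (proj₂ relays) e)

    Route : Fin k → Set
    Route i = Σ (List (Fin (size G))) λ vs → IsPath G (source T i) (target T i) vs × All (OnRoute i) vs

    directRoute : ∀ i → Adj G (source T i) (target T i) → Route i
    directRoute i s~t = source T i ∷ target T i ∷ []
                      , (step s~t (here _) , (source≢target T i i ∷ []) ∷ [] ∷ [])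
                      , at-source refl ∷ at-target refl ∷ []

    relayedRoute : ∀ i (p : ¬ Adj G (source T i) (target T i)) → Route i
    relayedRoute i p = source T i ∷ relay i p ∷ target T i ∷ []
                     , (step (proj₁ neighbours) (step (proj₂ neighbours) (here _))
                       , ((relay≢source i p i ∘ sym) ∷ source≢target T i i ∷ [])
                         ∷ (relay≢target i p i ∷ []) ∷ [] ∷ [])
                     , at-source refl ∷ at-relay p refl ∷ at-target refl ∷ []
      where
      neighbours : Adj G (source T i) (relay i p) × Adj G (relay i p) (target T i)
      neighbours = coMatching (source≢target T i i) p (relay≢source i p i) (relay≢target i p i)

    route : ∀ i → Route i
    route i with adj? (source T i) (target T i)
    ... | yes s~t = directRoute i s~t
    ... | no s≁t  = relayedRoute i s≁t

  coMatching⇒linkage : Linkage G T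
  coMatching⇒linkage = (λ i → proj₁ (route i)) , (λ i → proj₁ (proj₂ (route i))) , disjoint
    where
    disjoint : ∀ i j → i ≢ j → ∀ x → x ∈ proj₁ (route i) → x ∈ proj₁ (route j) → ⊥
    disjoint i j i≢j x x∈i x∈j =
      i≢j (onRoute-unique (All.lookup (proj₂ (proj₂ (route i))) x∈i)
                          (All.lookup (proj₂ (proj₂ (route j))) x∈j))

coMatching⇒linked : ∀ {G k c} → CoMatching G → Decidable (Adj G) → k + k + c ≤ size G →
  (∀ T → PairLabelling G T c) → Linked G k
coMatching⇒linked {G} {k} {c} coMatching adj? fits Λ =
  linkage⇒linked pairs-fit λ T → coMatching⇒linkage coMatching adj? T (Λ T) fits
  where
  pairs-fit : 2 * k ≤ size G
  pairs-fit = subst (_≤ size G) (cong (k +_) (sym (+-identityʳ k))) (≤-trans (m≤m+n (k + k) c) fits)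

-- Joins of graphs

JoinAdj : (G H : Graph) → Fin (size G) ⊎ Fin (size H) → Fin (size G) ⊎ Fin (size H) → Set
JoinAdj G H (inj₁ x) (inj₁ y) = Adj G x y
JoinAdj G H (inj₂ x) (inj₂ y) = Adj H x y
JoinAdj G H _        _        = ⊤

joinG-adj : ∀ G H x y → Adj (joinG G H) x y ≡ JoinAdj G H (splitAt (size G) x) (splitAt (size G) y)
joinG-adj G H x y with splitAt (size G) x | splitAt (size G) y
... | inj₁ _ | inj₁ _ = refl
... | inj₁ _ | inj₂ _ = refl
... | inj₂ _ | inj₁ _ = refl
... | inj₂ _ | inj₂ _ = refl

module _ {G H : Graph} where

  private
    split : Fin (size G + size H) → Fin (size G) ⊎ Fin (size H)
    split = splitAt (size G)

    toJoin : ∀ {x y} → JoinAdj G H (split x) (split y) → Adj (joinG G H) x y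
    toJoin {x} {y} = subst id (sym (joinG-adj G H x y))

    fromJoin : ∀ {x y} → Adj (joinG G H) x y → JoinAdj G H (split x) (split y)
    fromJoin {x} {y} = subst id (joinG-adj G H x y)

  joinG-adj? : Decidable (Adj G) → Decidable (Adj H) → Decidable (Adj (joinG G H))
  joinG-adj? G? H? x y = map′ toJoin fromJoin (joinAdj? (split x) (split y))
    where
    joinAdj? : Decidable (JoinAdj G H)
    joinAdj? (inj₁ a) (inj₁ b) = G? a b
    joinAdj? (inj₂ a) (inj₂ b) = H? a b
    joinAdj? (inj₁ _) (inj₂ _) = yes tt
    joinAdj? (inj₂ _) (inj₁ _) = yes tt

  joinG-coMatching : CoMatching G → CoMatching H → CoMatching (joinG G H)
  joinG-coMatching coG coH {x} {y} {z} x≢y x≁y z≢x z≢y =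
    Product.map (toJoin {x} {z}) (toJoin {z} {y})
      (common (x≢y ∘ splitAt-injective _) (x≁y ∘ toJoin) (z≢x ∘ splitAt-injective _) (z≢y ∘ splitAt-injective _))
    where
    common : ∀ {u v w} → u ≢ v → ¬ JoinAdj G H u v → w ≢ u → w ≢ v → JoinAdj G H u w × JoinAdj G H w v
    common {inj₁ a} {inj₁ b} {inj₁ c} a≢b a≁b c≢a c≢b =
      coG (a≢b ∘ cong inj₁) a≁b (c≢a ∘ cong inj₁) (c≢b ∘ cong inj₁)
    common {inj₂ a} {inj₂ b} {inj₂ c} a≢b a≁b c≢a c≢b =
      coH (a≢b ∘ cong inj₂) a≁b (c≢a ∘ cong inj₂) (c≢b ∘ cong inj₂)
    common {inj₁ _} {inj₁ _} {inj₂ _} _ _   _ _ = tt , tt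
    common {inj₂ _} {inj₂ _} {inj₁ _} _ _   _ _ = tt , tt
    common {inj₁ _} {inj₂ _}          _ a≁b _ _ = ⊥-elim (a≁b tt)
    common {inj₂ _} {inj₁ _}          _ a≁b _ _ = ⊥-elim (a≁b tt)

  joinG-nonEdgeLabelling : ∀ {c d} → NonEdgeLabelling G c → NonEdgeLabelling H d →
    NonEdgeLabelling (joinG G H) (c + d)
  joinG-nonEdgeLabelling {c} {d} ΛG ΛH = record
    { label           = λ {x} {y} p q → joinLabel (p ∘ splitAt-injective _) (q ∘ toJoin {x} {y})
    ; label-injective = λ _ _ _ _ eq →
        Sum.map (splitAt-injective _) (splitAt-injective _) (joinLabel-injective _ _ _ _ eq)
    }
    where
    module ΛG = NonEdgeLabelling ΛG
    module ΛH = NonEdgeLabelling ΛH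

    joinLabel : ∀ {u v} → u ≢ v → ¬ JoinAdj G H u v → Fin (c + d)
    joinLabel {inj₁ _} {inj₁ _} p q = ΛG.label (p ∘ cong inj₁) q ↑ˡ d
    joinLabel {inj₂ _} {inj₂ _} p q = c ↑ʳ ΛH.label (p ∘ cong inj₂) q
    joinLabel {inj₁ _} {inj₂ _} _ q = ⊥-elim (q tt)
    joinLabel {inj₂ _} {inj₁ _} _ q = ⊥-elim (q tt)

    joinLabel-injective : ∀ {u v u′ v′} p q p′ q′ →
      joinLabel {u} {v} p q ≡ joinLabel {u′} {v′} p′ q′ → u ≡ u′ ⊎ u ≡ v′
    joinLabel-injective {inj₁ _} {inj₁ _} {inj₁ _} {inj₁ _} _ _ _ _ eq =
      Sum.map (cong inj₁) (cong inj₁) (ΛG.label-injective _ _ _ _ (↑ˡ-injective d _ _ eq))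
    joinLabel-injective {inj₂ _} {inj₂ _} {inj₂ _} {inj₂ _} _ _ _ _ eq =
      Sum.map (cong inj₂) (cong inj₂) (ΛH.label-injective _ _ _ _ (↑ʳ-injective c _ _ eq))
    joinLabel-injective {inj₁ _} {inj₁ _} {inj₂ _} {inj₂ _} _ _ _ _ eq = ⊥-elim (↑ˡ≢↑ʳ _ _ eq)
    joinLabel-injective {inj₂ _} {inj₂ _} {inj₁ _} {inj₁ _} _ _ _ _ eq = ⊥-elim (↑ˡ≢↑ʳ _ _ (sym eq))
    joinLabel-injective {inj₁ _} {inj₂ _} _ q _ _  _ = ⊥-elim (q tt)
    joinLabel-injective {inj₂ _} {inj₁ _} _ q _ _  _ = ⊥-elim (q tt)
    joinLabel-injective {_} {_} {inj₁ _} {inj₂ _} _ _ _ q′ _ = ⊥-elim (q′ tt)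
    joinLabel-injective {_} {_} {inj₂ _} {inj₁ _} _ _ _ q′ _ = ⊥-elim (q′ tt)

  joinG-nonEdgeFamily : ∀ {c d} → NonEdgeFamily G c → NonEdgeFamily H d → NonEdgeFamily (joinG G H) (c + d)
  joinG-nonEdgeFamily {c} {d} F F′ =
    record { terminals = appendTerminals left right apart ; nonadjacent = nonadjacent′ }
    where
    inl-injective : Injective _≡_ _≡_ (_↑ˡ size H)
    inl-injective = ↑ˡ-injective (size H) _ _

    inr-injective : Injective _≡_ _≡_ (size G ↑ʳ_)
    inr-injective = ↑ʳ-injective (size G) _ _

    left : Terminals (size (joinG G H)) c
    left = mapTerminals (_↑ˡ size H) inl-injective (terminals F)

    right : Terminals (size (joinG G H)) d
    right = mapTerminals (size G ↑ʳ_) inr-injective (terminals F′)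

    apart : Apart left right
    apart i j eq = ↑ˡ≢↑ʳ _ _ (trans (sym (endpoints-map _ inl-injective (terminals F) i))
                                 (trans eq (endpoints-map _ inr-injective (terminals F′) j)))

    nonadjacent′ : ∀ i → ¬ Adj (joinG G H) (source (appendTerminals left right apart) i)
                                           (target (appendTerminals left right apart) i)
    nonadjacent′ i with splitAt c i
    ... | inj₁ a = nonadjacent F a
                     ∘ subst₂ (JoinAdj G H) (splitAt-↑ˡ _ _ _) (splitAt-↑ˡ _ _ _) ∘ fromJoin
    ... | inj₂ b = nonadjacent F′ b
                     ∘ subst₂ (JoinAdj G H) (splitAt-↑ʳ _ _ _) (splitAt-↑ʳ _ _ _) ∘ fromJoin

simplex-adj? : ∀ n → Decidable (Adj (simplexG n))
simplex-adj? n x y = ¬? (x ≟ y)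

simplex-coMatching : ∀ n → CoMatching (simplexG n)
simplex-coMatching n x≢y x≁y = ⊥-elim (x≁y x≢y)

simplex-nonEdgeLabelling : ∀ n → NonEdgeLabelling (simplexG n) 0
simplex-nonEdgeLabelling n = record
  { label = λ p q → ⊥-elim (q p) ; label-injective = λ p q _ _ _ → ⊥-elim (q p) }

simplex-nonEdgeFamily : ∀ n → NonEdgeFamily (simplexG n) 0
simplex-nonEdgeFamily n =
  record { terminals = terminalsFromInjection (λ ()) (λ { {()} }) ; nonadjacent = λ () }

square-adj? : Decidable (Adj squareG)
square-adj? i j = (_ Data.Nat.≟ _) ⊎-dec (_ Data.Nat.≟ _)

square-coMatching : CoMatching squareG
square-coMatching {x} {y} {z} = from-yes
  (all? λ x → all? λ y → all? λ z →
     ¬? (x ≟ y) →-dec ¬? (square-adj? x y) →-dec ¬? (z ≟ x) →-dec ¬? (z ≟ y) →-dec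
     (square-adj? x z ×-dec square-adj? z y)) x y z

-- The non-edges of □ are its diagonals {0, 2} and {1, 3}.
diagonal : Fin 4 → Fin 2
diagonal 0F = 0F
diagonal 1F = 1F
diagonal 2F = 0F
diagonal 3F = 1F

square-nonEdgeLabelling : NonEdgeLabelling squareG 2
square-nonEdgeLabelling = record
  { label           = λ {x} _ _ → diagonal x
  ; label-injective = λ {x} {y} {x′} {y′} → from-yes
      (all? λ x → all? λ y → all? λ x′ → all? λ y′ →
         ¬? (x ≟ y) →-dec ¬? (square-adj? x y) →-dec ¬? (x′ ≟ y′) →-dec ¬? (square-adj? x′ y′) →-dec
         (diagonal x ≟ diagonal x′) →-dec (x ≟ x′ ⊎-dec x ≟ y′)) x y x′ y′
  }

square-nonEdgeFamily : NonEdgeFamily squareG 2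
square-nonEdgeFamily = record
  { terminals   = terminalsFromInjection id id
  ; nonadjacent = λ { 0F (inj₁ ()) ; 0F (inj₂ ()) ; 1F (inj₁ ()) ; 1F (inj₂ ()) }
  }

-- The graph of P(n, m)

pg-size : ∀ n m → size (PG n m) ≡ n + 4 * m
pg-size n zero    = sym (+-identityʳ n)
pg-size n (suc m) = trans (cong (_+ 4) (pg-size n m)) (four-more n m)
  where
  four-more : ∀ n m → n + 4 * m + 4 ≡ n + 4 * suc m
  four-more = solve-∀

2*m+2≡2*[1+m] : ∀ m → 2 * m + 2 ≡ 2 * suc m
2*m+2≡2*[1+m] = solve-∀

pg-adj? : ∀ n m → Decidable (Adj (PG n m))
pg-adj? n zero    = simplex-adj? n
pg-adj? n (suc m) = joinG-adj? (pg-adj? n m) square-adj?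

pg-coMatching : ∀ n m → CoMatching (PG n m)
pg-coMatching n zero    = simplex-coMatching n
pg-coMatching n (suc m) = joinG-coMatching (pg-coMatching n m) square-coMatching

pg-nonEdgeLabelling : ∀ n m → NonEdgeLabelling (PG n m) (2 * m)
pg-nonEdgeLabelling n zero    = simplex-nonEdgeLabelling n
pg-nonEdgeLabelling n (suc m) = subst (NonEdgeLabelling (PG n (suc m))) (2*m+2≡2*[1+m] m)
  (joinG-nonEdgeLabelling (pg-nonEdgeLabelling n m) square-nonEdgeLabelling)

pg-nonEdgeFamily : ∀ n m → NonEdgeFamily (PG n m) (2 * m)
pg-nonEdgeFamily n zero    = simplex-nonEdgeFamily n
pg-nonEdgeFamily n (suc m) = subst (NonEdgeFamily (PG n (suc m))) (2*m+2≡2*[1+m] m)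
  (joinG-nonEdgeFamily (pg-nonEdgeFamily n m) square-nonEdgeFamily)

m*n≤o⇒m≤o/n : ∀ {m n o} .{{_ : NonZero n}} → m * n ≤ o → m ≤ o / n
m*n≤o⇒m≤o/n {m} {n} {o} le = subst (_≤ o / n) (m*n/n≡m m n) (/-monoˡ-≤ n le)

[4m+n]/3-fits : ∀ n m → let f = (4 * m + n) / 3 in f + f + f ≤ n + 4 * m
[4m+n]/3-fits n m = subst₂ _≤_ (triple ((4 * m + n) / 3)) (+-comm (4 * m) n) (m/n*n≤m (4 * m + n) 3)
  where
  triple : ∀ f → f * 3 ≡ f + f + f
  triple = solve-∀

[2m+n]/2-fits : ∀ n m → let f = (2 * m + n) / 2 in f + f + 2 * m ≤ n + 4 * m
[2m+n]/2-fits n m =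
  subst₂ _≤_ (double ((2 * m + n) / 2)) (regroup n m) (+-monoˡ-≤ (2 * m) (m/n*n≤m (2 * m + n) 2))
  where
  double : ∀ f → f * 2 + 2 * m ≡ f + f + 2 * m
  double = solve-∀
  regroup : ∀ n m → 2 * m + n + 2 * m ≡ n + 4 * m
  regroup = solve-∀

k*3≤4m+n : ∀ n m k → n + 1 ≤ 2 * m → k + k + k ⊓ (2 * m) ≤ n + 4 * m → k * 3 ≤ 4 * m + n
k*3≤4m+n n m k n<2m bound with ≤-total k (2 * m)
... | inj₁ k≤2m =
  subst₂ _≤_ (triple k) (+-comm n (4 * m)) (subst (λ x → k + k + x ≤ n + 4 * m) (m≤n⇒m⊓n≡m k≤2m) bound)
  where
  triple : ∀ k → k + k + k ≡ k * 3
  triple = solve-∀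
... | inj₂ 2m≤k = contradiction bound (<⇒≱ (begin-strict
    n + 4 * m                   ≡⟨ regroup n m ⟩
    n + 2 * m + 2 * m           <⟨ +-monoˡ-< (2 * m) (+-monoˡ-< (2 * m) (subst (_≤ 2 * m) (+-comm n 1) n<2m)) ⟩
    2 * m + 2 * m + 2 * m       ≤⟨ +-mono-≤ (+-mono-≤ 2m≤k 2m≤k) (≤-reflexive (sym (m≥n⇒m⊓n≡n 2m≤k))) ⟩
    k + k + k ⊓ (2 * m)         ∎))
  where
  open ≤-Reasoning
  regroup : ∀ n m → n + 4 * m ≡ n + 2 * m + 2 * m
  regroup = solve-∀

k*2≤2m+n : ∀ n m k → 2 * m ≤ n + 1 → k + k + k ⊓ (2 * m) ≤ n + 4 * m → k * 2 ≤ 2 * m + n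
k*2≤2m+n n m k 2m≤n+1 bound with ≤-<-connex (2 * m) k
... | inj₁ 2m≤k = subst₂ _≤_ (double k) (+-comm n (2 * m))
    (+-cancelʳ-≤ (2 * m) _ _ (subst₂ _≤_ (cong (k + k +_) (m≥n⇒m⊓n≡n 2m≤k)) (regroup n m) bound))
  where
  double : ∀ k → k + k ≡ k * 2
  double = solve-∀
  regroup : ∀ n m → n + 4 * m ≡ n + 2 * m + 2 * m
  regroup = solve-∀
... | inj₂ k<2m = ≤-pred (≤-pred (begin
    suc (suc (k * 2))  ≡⟨ double k ⟩
    suc k + suc k      ≤⟨ +-mono-≤ k<2m k<2m ⟩
    2 * m + 2 * m      ≤⟨ +-monoʳ-≤ (2 * m) 2m≤n+1 ⟩
    2 * m + (n + 1)    ≡⟨ shift n m ⟩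
    suc (2 * m + n)    ≤⟨ n≤1+n _ ⟩
    suc (suc (2 * m + n)) ∎))
  where
  open ≤-Reasoning
  double : ∀ k → suc (suc (k * 2)) ≡ suc k + suc k
  double = solve-∀
  shift : ∀ n m → 2 * m + (n + 1) ≡ suc (2 * m + n)
  shift = solve-∀

lemma3p5 : (n m : ℕ) →
    ((n + 1 ≤ 2 * m → LinkNumber (PG n m) ((4 * m + n) / 3)) ×
     (2 * m ≤ n + 1 → LinkNumber (PG n m) ((2 * m + n) / 2)))
lemma3p5 n m = small-n , large-n
  where
  fits : ∀ {x} → x ≤ n + 4 * m → x ≤ size (PG n m)
  fits = subst (_ ≤_) (sym (pg-size n m))

  bound : ∀ {k} → Linked (PG n m) k → k + k + k ⊓ (2 * m) ≤ n + 4 * m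
  bound {k} linked = subst (_ ≤_) (pg-size n m)
    (linked⇒k+k+b≤size linked (restrictFamily (pg-nonEdgeFamily n m) (m⊓n≤n k (2 * m))) (m⊓n≤m k (2 * m)))

  small-n : n + 1 ≤ 2 * m → LinkNumber (PG n m) ((4 * m + n) / 3)
  small-n n<2m =
      coMatching⇒linked (pg-coMatching n m) (pg-adj? n m) (fits ([4m+n]/3-fits n m)) indexLabelling
    , λ k linked → m*n≤o⇒m≤o/n {m = k} (k*3≤4m+n n m k n<2m (bound linked))

  large-n : 2 * m ≤ n + 1 → LinkNumber (PG n m) ((2 * m + n) / 2)
  large-n 2m≤n+1 =
      coMatching⇒linked (pg-coMatching n m) (pg-adj? n m) (fits ([2m+n]/2-fits n m))
        (nonEdgeLabelling⇒pairLabelling (pg-nonEdgeLabelling n m))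
    , λ k linked → m*n≤o⇒m≤o/n {m = k} (k*2≤2m+n n m k 2m≤n+1 (bound linked))
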